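{- For any integer $z\ge0$, if an undirected multigraph $G$ has a $z$-antler $(C_1,F_1)$ and $G-(C_1\cup F_1)$ has a $z$-antler $(C_2,F_2)$, then $(C_1\cup C_2,\,F_1\cup F_2)$ is a $z$-antler in $G$.
   Context: Graphs are undirected multigraphs, possibly with self-loops and parallel edges (these count as cycles). A feedback vertex set (FVS) of $G$ is a set $X\subseteq V(G)$ with $G-X$ acyclic; $\mathrm{fvs}(G)$ is its minimum size. For disjoint vertex sets $X,Y$, $e(X,Y)$ is the number of edges between them. A feedback vertex cut (FVC) in $G$ is a pair of disjoint sets $C,F\subseteq V(G)$ such that $G[F]$ is a forest and every tree $T$ of $G[F]$ satisfies $e(V(T),V(G)\setminus(C\cup F))\le1$. An antler is an FVC $(C,F)$ with $|C|\le\mathrm{fvs}(G[C\cup F])$. For $C\subseteq V(G)$, a $C$-certificate is a subgraph $H$ of $G$ such that $C$ is a minimum FVS of $H$; it has order $z$ if every connected component $H'$ of $H$ satisfies $\mathrm{fvs}(H')=|C\cap V(H')|\le z$. A $z$-antler is an antler $(C,F)$ such that $G[C\cup F]$ contains a $C$-certificate of order $z$. -}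

module Defs where

open import Data.Nat using (ℕ; zero; suc; _≤_)
open import Data.Bool using (Bool; true; false; _∧_; _∨_)
open import Data.Fin using (Fin; zero; suc; inject₁; fromℕ)
open import Data.Fin.Subset using (Subset; _∈_; _∉_; _⊆_; _∪_; _∩_; ∁; ∣_∣; Nonempty)
open import Data.Vec using (lookup; tabulate)
open import Data.Product using (Σ; _×_; _,_; proj₁; proj₂; Σ-syntax)
open import Data.Sum using (_⊎_)
open import Relation.Binary.PropositionalEquality using (_≡_)
open import Function.Definitions using (Injective)
open import Relation.Nullary using (¬_)

-- A finite undirected multigraph: vertices Fin #V, edges Fin #E,
-- each edge has an (unordered; stored as a pair) pair of endpoints.
-- Self-loops (ends e = (v , v)) and parallel edges are allowed.
record Multigraph : Set where
  field
    #V : ℕ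
    #E : ℕ
    ends : Fin #E → Fin #V × Fin #V

open Multigraph public

module _ (G : Multigraph) where

  src tgt : Fin (#E G) → Fin (#V G)
  src e = proj₁ (ends G e)
  tgt e = proj₂ (ends G e)

  Joins : Fin (#E G) → Fin (#V G) → Fin (#V G) → Set
  Joins e u v = (ends G e ≡ (u , v)) ⊎ (ends G e ≡ (v , u))

  inducedE : Subset (#V G) → Subset (#E G)
  inducedE S = tabulate (λ e → lookup S (src e) ∧ lookup S (tgt e))

  WellFormed : Subset (#V G) → Subset (#E G) → Set
  WellFormed S D = ∀ e → e ∈ D → (src e ∈ S) × (tgt e ∈ S)

  -- a cycle using only edges from D: distinct vertices v0..vk, distinct
  -- edges e0..ek (k ≥ 0), e_i joins v_i and v_{i+1}, e_k joins v_k and v_0.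
  -- (k = 0: self-loop; k = 1: two parallel edges.)
  record Cycle (D : Subset (#E G)) : Set where
    field
      len : ℕ
      vs : Fin (suc len) → Fin (#V G)
      es : Fin (suc len) → Fin (#E G)
      vs-inj : Injective _≡_ _≡_ vs
      es-inj : Injective _≡_ _≡_ es
      es-in : ∀ i → es i ∈ D
      step : ∀ (i : Fin len) → Joins (es (inject₁ i)) (vs (inject₁ i)) (vs (suc i))
      close : Joins (es (fromℕ len)) (vs (fromℕ len)) (vs zero)

  Acyclic : Subset (#E G) → Set
  Acyclic D = ¬ Cycle D

  IsFVS : Subset (#V G) → Subset (#E G) → Subset (#V G) → Set
  IsFVS S D X = (X ⊆ S) × Acyclic (D ∩ inducedE (∁ X))

  IsMinFVS : Subset (#V G) → Subset (#E G) → Subset (#V G) → Set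
  IsMinFVS S D X = IsFVS S D X × (∀ Y → IsFVS S D Y → ∣ X ∣ ≤ ∣ Y ∣)

  FvsIs : Subset (#V G) → Subset (#E G) → ℕ → Set
  FvsIs S D k = Σ[ X ∈ Subset (#V G) ] (IsMinFVS S D X × ∣ X ∣ ≡ k)

  data Reach (D : Subset (#E G)) : Fin (#V G) → Fin (#V G) → Set where
    here : ∀ {u} → Reach D u u
    there : ∀ {u w v} (e : Fin (#E G)) → e ∈ D → Joins e u w → Reach D w v → Reach D u v

  IsComponent : Subset (#V G) → Subset (#E G) → Subset (#V G) → Set
  IsComponent S D K =
    (K ⊆ S) × Nonempty K
    × (∀ u v → u ∈ K → v ∈ K → Reach D u v)
    × (∀ e → e ∈ D → (src e ∈ K → tgt e ∈ K) × (tgt e ∈ K → src e ∈ K))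

  cross : Subset (#V G) → Subset (#V G) → ℕ
  cross X Y = ∣ tabulate (λ e → (lookup X (src e) ∧ lookup Y (tgt e))
                               ∨ (lookup Y (src e) ∧ lookup X (tgt e))) ∣

  Disjoint : Subset (#V G) → Subset (#V G) → Set
  Disjoint A B = ∀ v → v ∈ A → v ∉ B

  -- All notions below are relative to the induced subgraph G[W]
  -- (W = ⊤ gives G itself; W = ∁ X gives G - X).

  IsFVC : Subset (#V G) → Subset (#V G) → Subset (#V G) → Set
  IsFVC W C F =
    (C ⊆ W) × (F ⊆ W) × Disjoint C F
    × Acyclic (inducedE F)
    × (∀ T → IsComponent F (inducedE F) T → cross T (W ∩ ∁ (C ∪ F)) ≤ 1)

  IsAntler : Subset (#V G) → Subset (#V G) → Subset (#V G) → Set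
  IsAntler W C F =
    IsFVC W C F
    × (∀ Y → IsFVS (C ∪ F) (inducedE (C ∪ F)) Y → ∣ C ∣ ≤ ∣ Y ∣)

  IsCertificate : ℕ → Subset (#V G) → Subset (#V G) → Subset (#V G) → Subset (#E G) → Set
  IsCertificate z A C S D =
    (S ⊆ A) × (D ⊆ inducedE A) × WellFormed S D
    × IsMinFVS S D C
    × (∀ K → IsComponent S D K →
         FvsIs K (D ∩ inducedE K) ∣ C ∩ K ∣ × ∣ C ∩ K ∣ ≤ z)

  IsZAntler : ℕ → Subset (#V G) → Subset (#V G) → Subset (#V G) → Set
  IsZAntler z W C F =
    IsAntler W C F
    × Σ[ S ∈ Subset (#V G) ] Σ[ D ∈ Subset (#E G) ] IsCertificate z (C ∪ F) C S D

module Submission where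

-- A tree K of G[F₁] has at most one edge into G - (C₁ ∪ F₁) ⊇ F₂, and a cycle or walk of G[F₁ ∪ F₂] that
-- leaves K through that edge can only come back through the same edge. Hence every cycle of G[F₁ ∪ F₂] lies
-- in G[F₁] or in G[F₂], and a tree of G[F₁ ∪ F₂] is either a single tree of G[F₁] or a tree T₂ of G[F₂] with
-- trees of G[F₁] hanging from it by single edges, in which case all its edges to G - (C ∪ F) leave from T₂.
-- Feedback vertex sets are superadditive over vertex-disjoint subgraphs; this gives |C₁ ∪ C₂| ≤ fvs(G[C ∪ F])
-- and the minimality of C₁ ∪ C₂ in the union of the two certificates, whose components are components of
-- one of them and so keep order at most z.

open import Algebra.Bundles using (CommutativeMonoid)
import Algebra.Properties.CommutativeSemigroup as CommutativeSemigroupProperties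
open import Data.Bool using (Bool; true; false; _∧_; _∨_)
open import Data.Bool.Properties using (∧-conicalˡ; ∧-conicalʳ; ∨-sel; ∨-zeroʳ)
open import Data.Empty using (⊥; ⊥-elim)
open import Data.Fin using (Fin; zero; suc; inject₁; fromℕ; toℕ)
open import Data.Fin.Induction using (<-weakInduction; >-weakInduction)
open import Data.Fin.Properties using (toℕ-inject₁; any?; suc-injective)
open import Data.Fin.Subset using (Subset; _∈_; _∉_; _⊆_; _⊂_; _∪_; _∩_; ∁; ∣_∣; ⊤; ⁅_⁆; Empty)
open import Data.Fin.Subset.Properties
  using ( _∈?_; ∈⊤; x∈p∪q⁺; x∈p∪q⁻; x∈p∩q⁺; x∈p∩q⁻; p∩q⊆p; p∩q⊆q; p⊆p∪q; q⊆p∪q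
        ; x∈∁p⇒x∉p; x∉p⇒x∈∁p; p⊆q⇒∁p⊇∁q; ⊆-refl; ⊆-trans; ⊆-antisym; p⊆q⇒∣p∣≤∣q∣; p⊂q⇒∣p∣<∣q∣
        ; x∈⁅x⁆; x∈⁅y⁆⇒x≡y; Empty-unique; ∣⊥∣≡0; ∪-commutativeMonoid )
open import Data.Nat using (ℕ; suc; _≤_; _<_; _+_; z≤n; s≤s)
open import Data.Nat.Induction using (<-wellFounded)
open import Data.Nat.Properties
  using (≤-refl; ≤-trans; ≤-reflexive; <-irrefl; <-≤-trans; <⇒≤; m<n⇒m<1+n; +-mono-≤; +-suc; module ≤-Reasoning)
open import Data.Product using (Σ-syntax; ∃-syntax; _×_; _,_; proj₁; proj₂)
open import Data.Sum using (_⊎_; inj₁; inj₂; [_,_]′; swap)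
open import Data.Vec using ([]; _∷_; lookup; tabulate; here; there)
open import Data.Vec.Properties using ([]=⇒lookup; lookup⇒[]=; lookup∘tabulate)
open import Induction.WellFounded using (Acc; acc)
open import Relation.Binary.PropositionalEquality using (_≡_; refl; sym; trans; cong; cong₂; subst; subst₂)
open import Relation.Nullary using (¬_; Dec; yes; no)
open import Relation.Nullary.Decidable using (_×-dec_; _⊎-dec_; ¬?; decidable-stable)
open import Relation.Nullary.Negation using (contradiction)
open import Relation.Unary using (Decidable)

open import Defs

-- Subsets of a finite set

module _ {n : ℕ} where

  private variable
    p q r s : Subset n
    x y : Fin n
    f : Fin n → Bool

  ∈tabulate⁺ : f x ≡ true → x ∈ tabulate f
  ∈tabulate⁺ {f = f} {x = x} fx≡true = lookup⇒[]= x (tabulate f) (trans (lookup∘tabulate f x) fx≡true)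

  ∈tabulate⁻ : x ∈ tabulate f → f x ≡ true
  ∈tabulate⁻ {x = x} {f = f} x∈ = trans (sym (lookup∘tabulate f x)) ([]=⇒lookup x∈)

  ∪-⊆ : p ⊆ r → q ⊆ r → p ∪ q ⊆ r
  ∪-⊆ {p = p} {q = q} p⊆r q⊆r x∈p∪q = [ p⊆r , q⊆r ]′ (x∈p∪q⁻ p q x∈p∪q)

  ∪-mono-⊆ : p ⊆ r → q ⊆ s → p ∪ q ⊆ r ∪ s
  ∪-mono-⊆ {s = s} p⊆r q⊆s = ∪-⊆ (λ x∈p → p⊆p∪q s (p⊆r x∈p)) (λ x∈q → q⊆p∪q _ s (q⊆s x∈q))

  p∪q⊆q∪p : p ∪ q ⊆ q ∪ p
  p∪q⊆q∪p {q = q} = ∪-⊆ (q⊆p∪q q _) (p⊆p∪q _)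

  ∈⁅⁆-elim : (P : Fin n → Set) → P y → x ∈ ⁅ y ⁆ → P x
  ∈⁅⁆-elim {y = y} P Py x∈⁅y⁆ = subst P (sym (x∈⁅y⁆⇒x≡y y x∈⁅y⁆)) Py

  p∩s≡q∩s : p ⊆ q ∪ r → q ⊆ p → (∀ x → x ∈ s → x ∉ r) → p ∩ s ≡ q ∩ s
  p∩s≡q∩s {p = p} {q = q} {r = r} {s = s} p⊆q∪r q⊆p s∩r=∅ = ⊆-antisym restrict extend
    where
    restrict : p ∩ s ⊆ q ∩ s
    restrict x∈p∩s with x∈p∩q⁻ p s x∈p∩s
    ... | x∈p , x∈s with x∈p∪q⁻ q r (p⊆q∪r x∈p)
    ...   | inj₁ x∈q = x∈p∩q⁺ (x∈q , x∈s)
    ...   | inj₂ x∈r = contradiction x∈r (s∩r=∅ _ x∈s)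
    extend : q ∩ s ⊆ p ∩ s
    extend x∈q∩s with x∈p∩q⁻ q s x∈q∩s
    ... | x∈q , x∈s = x∈p∩q⁺ (q⊆p x∈q , x∈s)

disjoint-tail : ∀ {n a b} {p q : Subset n} → (∀ x → x ∈ a ∷ p → x ∉ b ∷ q) → ∀ x → x ∈ p → x ∉ q
disjoint-tail disjoint x x∈p x∈q = disjoint (suc x) (there x∈p) (there x∈q)

1≤∣p∣ : ∀ {n} {x : Fin n} (p : Subset n) → x ∈ p → 1 ≤ ∣ p ∣
1≤∣p∣ (true ∷ p) here = s≤s z≤n
1≤∣p∣ (true ∷ p) (there x∈p) = s≤s z≤n
1≤∣p∣ (false ∷ p) (there x∈p) = 1≤∣p∣ p x∈p

∣p∣≤1⇒unique : ∀ {n} (p : Subset n) → ∣ p ∣ ≤ 1 → ∀ {x y} → x ∈ p → y ∈ p → x ≡ y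
∣p∣≤1⇒unique (true ∷ p) _ here here = refl
∣p∣≤1⇒unique (true ∷ p) (s≤s ∣p∣≤0) here (there y∈p) = contradiction (≤-trans (1≤∣p∣ p y∈p) ∣p∣≤0) λ ()
∣p∣≤1⇒unique (true ∷ p) (s≤s ∣p∣≤0) (there x∈p) _ = contradiction (≤-trans (1≤∣p∣ p x∈p) ∣p∣≤0) λ ()
∣p∣≤1⇒unique (false ∷ p) ∣p∣≤1 (there x∈p) (there y∈p) = cong suc (∣p∣≤1⇒unique p ∣p∣≤1 x∈p y∈p)

unique⇒∣p∣≤1 : ∀ {n} (p : Subset n) → (∀ {x y} → x ∈ p → y ∈ p → x ≡ y) → ∣ p ∣ ≤ 1
unique⇒∣p∣≤1 [] _ = z≤n
unique⇒∣p∣≤1 {suc n} (true ∷ p) unique = s≤s (≤-reflexive (trans (cong ∣_∣ (Empty-unique p-empty)) (∣⊥∣≡0 n)))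
  where
  p-empty : Empty p
  p-empty (x , x∈p) with unique here (there x∈p)
  ... | ()
unique⇒∣p∣≤1 (false ∷ p) unique = unique⇒∣p∣≤1 p (λ x∈p y∈p → suc-injective (unique (there x∈p) (there y∈p)))

∣p∪q∣≡∣p∣+∣q∣ : ∀ {n} (p q : Subset n) → (∀ x → x ∈ p → x ∉ q) → ∣ p ∪ q ∣ ≡ ∣ p ∣ + ∣ q ∣
∣p∪q∣≡∣p∣+∣q∣ [] [] _ = refl
∣p∪q∣≡∣p∣+∣q∣ (true ∷ p) (true ∷ q) p∩q=∅ = contradiction here (p∩q=∅ zero here)
∣p∪q∣≡∣p∣+∣q∣ (true ∷ p) (false ∷ q) p∩q=∅ = cong suc (∣p∪q∣≡∣p∣+∣q∣ p q (disjoint-tail p∩q=∅))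
∣p∪q∣≡∣p∣+∣q∣ (false ∷ p) (true ∷ q) p∩q=∅ =
  trans (cong suc (∣p∪q∣≡∣p∣+∣q∣ p q (disjoint-tail p∩q=∅))) (sym (+-suc ∣ p ∣ ∣ q ∣))
∣p∪q∣≡∣p∣+∣q∣ (false ∷ p) (false ∷ q) p∩q=∅ = ∣p∪q∣≡∣p∣+∣q∣ p q (disjoint-tail p∩q=∅)

∣p∩q∣+∣p∩r∣≤∣p∣ : ∀ {n} (p q r : Subset n) → (∀ x → x ∈ q → x ∉ r) → ∣ p ∩ q ∣ + ∣ p ∩ r ∣ ≤ ∣ p ∣
∣p∩q∣+∣p∩r∣≤∣p∣ p q r q∩r=∅ = begin
  ∣ p ∩ q ∣ + ∣ p ∩ r ∣  ≡⟨ sym (∣p∪q∣≡∣p∣+∣q∣ (p ∩ q) (p ∩ r) disjoint) ⟩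
  ∣ p ∩ q ∪ p ∩ r ∣      ≤⟨ p⊆q⇒∣p∣≤∣q∣ (∪-⊆ (p∩q⊆p p q) (p∩q⊆p p r)) ⟩
  ∣ p ∣                  ∎
  where
  open ≤-Reasoning
  disjoint : ∀ x → x ∈ p ∩ q → x ∉ p ∩ r
  disjoint x x∈p∩q x∈p∩r = q∩r=∅ x (p∩q⊆q p q x∈p∩q) (p∩q⊆q p r x∈p∩r)

∪-interchange : ∀ {n} (p q r s : Subset n) → (p ∪ q) ∪ (r ∪ s) ≡ (p ∪ r) ∪ (q ∪ s)
∪-interchange {n} = interchange
  where open CommutativeSemigroupProperties (CommutativeMonoid.commutativeSemigroup (∪-commutativeMonoid n))

module _ (G : Multigraph) where

  Vertex : Set
  Vertex = Fin (#V G)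

  Edge : Set
  Edge = Fin (#E G)

  private variable
    e e′ f : Edge
    u u′ v w w′ x y : Vertex
    S S′ S₁ S₂ K T X Y : Subset (#V G)
    D D′ D₁ D₂ : Subset (#E G)
    k₁ k₂ : ℕ

  ∈inducedE⁺ : src G e ∈ S → tgt G e ∈ S → e ∈ inducedE G S
  ∈inducedE⁺ src∈S tgt∈S = ∈tabulate⁺ (cong₂ _∧_ ([]=⇒lookup src∈S) ([]=⇒lookup tgt∈S))

  inducedE-wellFormed : WellFormed G S (inducedE G S)
  inducedE-wellFormed {S = S} e e∈ =
    lookup⇒[]= _ S (∧-conicalˡ _ _ ends∈S) , lookup⇒[]= _ S (∧-conicalʳ _ _ ends∈S)
    where
    ends∈S : lookup S (src G e) ∧ lookup S (tgt G e) ≡ true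
    ends∈S = ∈tabulate⁻ e∈

  inducedE-mono : S ⊆ S′ → inducedE G S ⊆ inducedE G S′
  inducedE-mono S⊆S′ e∈ with inducedE-wellFormed _ e∈
  ... | src∈S , tgt∈S = ∈inducedE⁺ (S⊆S′ src∈S) (S⊆S′ tgt∈S)

  Joins-sym : Joins G e u v → Joins G e v u
  Joins-sym = swap

  Joins⇒ends : Joins G e u v → (src G e ≡ u × tgt G e ≡ v) ⊎ (src G e ≡ v × tgt G e ≡ u)
  Joins⇒ends (inj₁ ends≡) = inj₁ (cong proj₁ ends≡ , cong proj₂ ends≡)
  Joins⇒ends (inj₂ ends≡) = inj₂ (cong proj₁ ends≡ , cong proj₂ ends≡)

  Joins-endpoint : Joins G e u v → Joins G e x y → x ≡ u ⊎ x ≡ v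
  Joins-endpoint j j′ with Joins⇒ends j | Joins⇒ends j′
  ... | inj₁ (refl , refl) | inj₁ (refl , refl) = inj₁ refl
  ... | inj₁ (refl , refl) | inj₂ (refl , refl) = inj₂ refl
  ... | inj₂ (refl , refl) | inj₁ (refl , refl) = inj₂ refl
  ... | inj₂ (refl , refl) | inj₂ (refl , refl) = inj₁ refl

  Joins-∈inducedE : Joins G e u v → u ∈ S → v ∈ S → e ∈ inducedE G S
  Joins-∈inducedE j u∈S v∈S with Joins⇒ends j
  ... | inj₁ (refl , refl) = ∈inducedE⁺ u∈S v∈S
  ... | inj₂ (refl , refl) = ∈inducedE⁺ v∈S u∈S

  WellFormed-Joins : WellFormed G S D → e ∈ D → Joins G e u v → u ∈ S × v ∈ S
  WellFormed-Joins wf e∈D j with wf _ e∈D | Joins⇒ends j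
  ... | src∈S , tgt∈S | inj₁ (refl , refl) = src∈S , tgt∈S
  ... | src∈S , tgt∈S | inj₂ (refl , refl) = tgt∈S , src∈S

  Reach-snoc : Reach G D u v → e ∈ D → Joins G e v w → Reach G D u w
  Reach-snoc here e∈D j = there _ e∈D j here
  Reach-snoc (there f f∈D j′ r) e∈D j = there f f∈D j′ (Reach-snoc r e∈D j)

  Reach-trans : Reach G D u v → Reach G D v w → Reach G D u w
  Reach-trans here r = r
  Reach-trans (there e e∈D j r) r′ = there e e∈D j (Reach-trans r r′)

  Reach-sym : Reach G D u v → Reach G D v u
  Reach-sym here = here
  Reach-sym (there e e∈D j r) = Reach-snoc (Reach-sym r) e∈D (Joins-sym j)

  Reach-preserves : (P : Vertex → Set) → (∀ {e x y} → e ∈ D → Joins G e x y → P x → P y)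
                  → Reach G D u v → P u → P v
  Reach-preserves P step here Pu = Pu
  Reach-preserves P step (there e e∈D j r) Pu = Reach-preserves P step r (step e∈D j Pu)

  Exit : Subset (#V G) → Subset (#V G) → Edge → Set
  Exit T X e = Σ[ u ∈ Vertex ] Σ[ w ∈ Vertex ] (Joins G e u w × u ∈ T × w ∈ X)

  crossingEdges : Subset (#V G) → Subset (#V G) → Subset (#E G)
  crossingEdges T X = tabulate (λ e → (lookup T (src G e) ∧ lookup X (tgt G e))
                                     ∨ (lookup X (src G e) ∧ lookup T (tgt G e)))

  Exit⇒∈crossingEdges : Exit T X e → e ∈ crossingEdges T X
  Exit⇒∈crossingEdges {T = T} {X = X} {e = e} (u , w , j , u∈T , w∈X) with Joins⇒ends j
  ... | inj₁ (refl , refl) =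
    ∈tabulate⁺ (cong (_∨ (lookup X (src G e) ∧ lookup T (tgt G e))) (cong₂ _∧_ ([]=⇒lookup u∈T) ([]=⇒lookup w∈X)))
  ... | inj₂ (refl , refl) =
    ∈tabulate⁺ (trans (cong (lookup T (src G e) ∧ lookup X (tgt G e) ∨_) (cong₂ _∧_ ([]=⇒lookup w∈X) ([]=⇒lookup u∈T)))
                      (∨-zeroʳ _))

  ∈crossingEdges⇒Exit : e ∈ crossingEdges T X → Exit T X e
  ∈crossingEdges⇒Exit {e = e} {T = T} {X = X} e∈ with ∨-sel (lookup T (src G e) ∧ lookup X (tgt G e))
                                                            (lookup X (src G e) ∧ lookup T (tgt G e))
  ... | inj₁ ≡left = src G e , tgt G e , inj₁ refl , lookup⇒[]= _ T (∧-conicalˡ _ _ left)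
                                                  , lookup⇒[]= _ X (∧-conicalʳ _ _ left)
    where
    left : lookup T (src G e) ∧ lookup X (tgt G e) ≡ true
    left = trans (sym ≡left) (∈tabulate⁻ e∈)
  ... | inj₂ ≡right = tgt G e , src G e , inj₂ refl , lookup⇒[]= _ T (∧-conicalʳ _ _ right)
                                                   , lookup⇒[]= _ X (∧-conicalˡ _ _ right)
    where
    right : lookup X (src G e) ∧ lookup T (tgt G e) ≡ true
    right = trans (sym ≡right) (∈tabulate⁻ e∈)

  cross≤1⇒unique-exit : cross G T X ≤ 1 → Exit T X e → Exit T X e′ → e ≡ e′
  cross≤1⇒unique-exit {T = T} {X = X} cross≤1 exit exit′ =
    ∣p∣≤1⇒unique (crossingEdges T X) cross≤1 (Exit⇒∈crossingEdges exit) (Exit⇒∈crossingEdges exit′)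

  unique-exit⇒cross≤1 : (∀ {e e′} → Exit T X e → Exit T X e′ → e ≡ e′) → cross G T X ≤ 1
  unique-exit⇒cross≤1 {T = T} {X = X} unique =
    unique⇒∣p∣≤1 (crossingEdges T X) (λ e∈ e′∈ → unique (∈crossingEdges⇒Exit e∈) (∈crossingEdges⇒Exit e′∈))

  -- Cycles

  Leaves : (Vertex → Set) → Edge → Set
  Leaves P e = Σ[ u ∈ Vertex ] Σ[ w ∈ Vertex ] (Joins G e u w × P u × ¬ P w)

  module _ (c : Cycle G D) where
    open Cycle c

    Cycle-within : (∀ i → es i ∈ D′) → Cycle G D′
    Cycle-within es∈D′ = record
      { len = len ; vs = vs ; es = es ; vs-inj = vs-inj ; es-inj = es-inj
      ; es-in = es∈D′ ; step = step ; close = close }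

    edge-from : ∀ i → ∃[ j ] Joins G (es i) (vs i) (vs j)
    edge-from = >-weakInduction _ (zero , close) (λ i _ → suc i , step i)

    Cycle-inducedE : (∀ i → vs i ∈ S) → Cycle G (inducedE G S)
    Cycle-inducedE vs∈S = Cycle-within λ i → let j , e = edge-from i in Joins-∈inducedE e (vs∈S i) (vs∈S j)

    -- A vertex vs i on the other side of P from vs zero forces a crossing edge before position i and
    -- another at or after it; these are distinct by injectivity of es.
    module _ (P : Vertex → Set) (P? : Decidable P) where
      private
        Separates : Vertex → Vertex → Set
        Separates a b = (P a × ¬ P b) ⊎ (P b × ¬ P a)

        separates-via : ∀ {a b} m → Separates a b → Separates a m ⊎ Separates m b
        separates-via m s with P? m
        separates-via m (inj₁ (Pa , ¬Pb)) | yes Pm = inj₂ (inj₁ (Pm , ¬Pb))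
        separates-via m (inj₂ (Pb , ¬Pa)) | yes Pm = inj₁ (inj₂ (Pm , ¬Pa))
        separates-via m (inj₁ (Pa , ¬Pb)) | no ¬Pm = inj₁ (inj₁ (Pa , ¬Pm))
        separates-via m (inj₂ (Pb , ¬Pa)) | no ¬Pm = inj₂ (inj₂ (Pb , ¬Pm))

        leaves : ∀ {e a b} → Joins G e a b → Separates a b → Leaves P e
        leaves {a = a} {b} j (inj₁ (Pa , ¬Pb)) = a , b , j , Pa , ¬Pb
        leaves {a = a} {b} j (inj₂ (Pb , ¬Pa)) = b , a , Joins-sym j , Pb , ¬Pa

        leaves-before : ∀ i → Separates (vs zero) (vs i) → ∃[ j ] (toℕ j < toℕ i × Leaves P (es j))
        leaves-before = <-weakInduction _ (λ { (inj₁ (P₀ , ¬P₀)) → ⊥-elim (¬P₀ P₀)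
                                             ; (inj₂ (P₀ , ¬P₀)) → ⊥-elim (¬P₀ P₀) }) next
          where
          next : ∀ i → (Separates (vs zero) (vs (inject₁ i)) → ∃[ j ] (toℕ j < toℕ (inject₁ i) × Leaves P (es j)))
               → Separates (vs zero) (vs (suc i)) → ∃[ j ] (toℕ j < toℕ (suc i) × Leaves P (es j))
          next i before s with separates-via (vs (inject₁ i)) s
          ... | inj₂ s′ = inject₁ i , s≤s (≤-reflexive (toℕ-inject₁ i)) , leaves (step i) s′
          ... | inj₁ s′ with before s′
          ...   | j , j<i , l = j , m<n⇒m<1+n (subst (toℕ j <_) (toℕ-inject₁ i) j<i) , l

        leaves-after : ∀ i → Separates (vs i) (vs zero) → ∃[ k ] (toℕ i ≤ toℕ k × Leaves P (es k))
        leaves-after = >-weakInduction _ (λ s → fromℕ len , ≤-refl , leaves close s) next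
          where
          next : ∀ i → (Separates (vs (suc i)) (vs zero) → ∃[ k ] (toℕ (suc i) ≤ toℕ k × Leaves P (es k)))
               → Separates (vs (inject₁ i)) (vs zero) → ∃[ k ] (toℕ (inject₁ i) ≤ toℕ k × Leaves P (es k))
          next i after s with separates-via (vs (suc i)) s
          ... | inj₁ s′ = inject₁ i , ≤-refl , leaves (step i) s′
          ... | inj₂ s′ with after s′
          ...   | k , i<k , l = k , subst (_≤ toℕ k) (sym (toℕ-inject₁ i)) (<⇒≤ i<k) , l

        never-separated : (∀ {i j} → Leaves P (es i) → Leaves P (es j) → es i ≡ es j)
                        → ∀ i → ¬ Separates (vs zero) (vs i)
        never-separated unique i s with leaves-before i s | leaves-after i (swap s)
        ... | j , j<i , l | k , i≤k , l′ with es-inj (unique l l′)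
        ... | refl = <-irrefl refl (<-≤-trans j<i i≤k)

      cycle-confined : (∀ {i j} → Leaves P (es i) → Leaves P (es j) → es i ≡ es j)
                     → ∀ {i} → P (vs i) → ∀ j → P (vs j)
      cycle-confined unique {i} Pᵢ j with P? (vs zero) | P? (vs j)
      ... | _ | yes Pⱼ = Pⱼ
      ... | yes P₀ | no ¬Pⱼ = ⊥-elim (never-separated unique j (inj₁ (P₀ , ¬Pⱼ)))
      ... | no ¬P₀ | no _ = ⊥-elim (never-separated unique i (inj₂ (Pᵢ , ¬P₀)))

  -- Connected components

  component-closed : IsComponent G S D K → e ∈ D → Joins G e u w → u ∈ K → w ∈ K
  component-closed (_ , _ , _ , closed) e∈D j u∈K with Joins⇒ends j
  ... | inj₁ (refl , refl) = proj₁ (closed _ e∈D) u∈K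
  ... | inj₂ (refl , refl) = proj₂ (closed _ e∈D) u∈K

  component-exit : IsComponent G S (inducedE G S) K → e ∈ inducedE G (S ∪ S′) → Joins G e u w
                 → u ∈ K → w ∉ K → w ∈ S′
  component-exit {S = S} {S′ = S′} K-comp e∈ j u∈K w∉K
    with x∈p∪q⁻ S S′ (proj₂ (WellFormed-Joins inducedE-wellFormed e∈ j))
  ... | inj₁ w∈S = contradiction (component-closed K-comp (Joins-∈inducedE j (proj₁ K-comp u∈K) w∈S) j u∈K) w∉K
  ... | inj₂ w∈S′ = w∈S′

  module _ (F : Subset (#V G)) (v : Vertex) where
    private
      Reached : Subset (#V G) → Set
      Reached K = v ∈ K × (∀ {x} → x ∈ K → x ∈ F × Reach G (inducedE G F) v x)

      Boundary : Subset (#V G) → Edge → Set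
      Boundary K e = e ∈ inducedE G F
                   × ((src G e ∈ K × tgt G e ∉ K) ⊎ (tgt G e ∈ K × src G e ∉ K))

      boundary? : ∀ K → Decidable (Boundary K)
      boundary? K e = (e ∈? inducedE G F)
        ×-dec (((src G e ∈? K) ×-dec ¬? (tgt G e ∈? K)) ⊎-dec ((tgt G e ∈? K) ×-dec ¬? (src G e ∈? K)))

      extend-along : Reached K → e ∈ inducedE G F → Joins G e x y → x ∈ K → y ∉ K
                   → Σ[ K′ ∈ Subset (#V G) ] (Reached K′ × ∣ ∁ K′ ∣ < ∣ ∁ K ∣)
      extend-along {K = K} {y = y} (v∈K , inside) e∈ j x∈K y∉K =
        K ∪ ⁅ y ⁆ , (p⊆p∪q _ v∈K , inside′) , p⊂q⇒∣p∣<∣q∣ shrinks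
        where
        inside′ : ∀ {z} → z ∈ K ∪ ⁅ y ⁆ → z ∈ F × Reach G (inducedE G F) v z
        inside′ z∈ = [ inside , ∈⁅⁆-elim (λ z → z ∈ F × Reach G (inducedE G F) v z)
                                         ( proj₂ (WellFormed-Joins inducedE-wellFormed e∈ j)
                                         , Reach-snoc (proj₂ (inside x∈K)) e∈ j) ]′ (x∈p∪q⁻ K ⁅ y ⁆ z∈)
        shrinks : ∁ (K ∪ ⁅ y ⁆) ⊂ ∁ K
        shrinks = p⊆q⇒∁p⊇∁q (p⊆p∪q _) , y , x∉p⇒x∈∁p y∉K
                , λ y∈∁ → x∈∁p⇒x∉p y∈∁ (q⊆p∪q K ⁅ y ⁆ (x∈⁅x⁆ y))

      grow : ∀ K → Acc _<_ ∣ ∁ K ∣ → Reached K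
           → Σ[ K′ ∈ Subset (#V G) ] (IsComponent G F (inducedE G F) K′ × v ∈ K′)
      grow K (acc smaller) reached with any? (boundary? K)
      ... | yes (e , e∈ , inj₁ (src∈K , tgt∉K)) with extend-along reached e∈ (inj₁ refl) src∈K tgt∉K
      ...   | K′ , reached′ , shrinks = grow K′ (smaller shrinks) reached′
      grow K (acc smaller) reached | yes (e , e∈ , inj₂ (tgt∈K , src∉K))
        with extend-along reached e∈ (inj₂ refl) tgt∈K src∉K
      ...   | K′ , reached′ , shrinks = grow K′ (smaller shrinks) reached′
      grow K (acc smaller) (v∈K , inside) | no no-boundary =
        K , (K⊆F , (v , v∈K) , connected , closed) , v∈K
        where
        K⊆F : K ⊆ F
        K⊆F x∈K = proj₁ (inside x∈K)
        connected : ∀ x y → x ∈ K → y ∈ K → Reach G (inducedE G F) x y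
        connected _ _ x∈K y∈K = Reach-trans (Reach-sym (proj₂ (inside x∈K))) (proj₂ (inside y∈K))
        closed : ∀ e → e ∈ inducedE G F → (src G e ∈ K → tgt G e ∈ K) × (tgt G e ∈ K → src G e ∈ K)
        closed e e∈ = (λ src∈K → decidable-stable (_ ∈? K) λ tgt∉K → no-boundary (e , e∈ , inj₁ (src∈K , tgt∉K)))
                    , (λ tgt∈K → decidable-stable (_ ∈? K) λ src∉K → no-boundary (e , e∈ , inj₂ (tgt∈K , src∉K)))

    component-of : v ∈ F → Σ[ K ∈ Subset (#V G) ] (IsComponent G F (inducedE G F) K × v ∈ K)
    component-of v∈F = grow ⁅ v ⁆ (<-wellFounded _)
      (x∈⁅x⁆ v , ∈⁅⁆-elim (λ x → x ∈ F × Reach G (inducedE G F) v x) (v∈F , here))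

  -- Feedback vertex sets

  Acyclic-anti : D ⊆ D′ → Acyclic G D′ → Acyclic G D
  Acyclic-anti D⊆D′ acyclic c = acyclic (Cycle-within c (λ i → D⊆D′ (Cycle.es-in c i)))

  IsFVS-restrict : WellFormed G S′ D′ → D′ ⊆ D → IsFVS G S D Y → IsFVS G S′ D′ (Y ∩ S′)
  IsFVS-restrict {S′ = S′} {D′ = D′} {D = D} {Y = Y} wf D′⊆D (_ , acyclic) =
    p∩q⊆q Y S′ , Acyclic-anti avoids-Y acyclic
    where
    outside-Y : ∀ {x} → x ∈ S′ → x ∈ ∁ (Y ∩ S′) → x ∈ ∁ Y
    outside-Y x∈S′ x∉ = x∉p⇒x∈∁p (λ x∈Y → x∈∁p⇒x∉p x∉ (x∈p∩q⁺ (x∈Y , x∈S′)))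
    avoids-Y : D′ ∩ inducedE G (∁ (Y ∩ S′)) ⊆ D ∩ inducedE G (∁ Y)
    avoids-Y e∈ with x∈p∩q⁻ D′ _ e∈
    ... | e∈D′ , e∈avoid with wf _ e∈D′ | inducedE-wellFormed _ e∈avoid
    ...   | src∈S′ , tgt∈S′ | src∉ , tgt∉ =
      x∈p∩q⁺ (D′⊆D e∈D′ , ∈inducedE⁺ (outside-Y src∈S′ src∉) (outside-Y tgt∈S′ tgt∉))

  FvsAtLeast : Subset (#V G) → Subset (#E G) → ℕ → Set
  FvsAtLeast S D k = ∀ Y → IsFVS G S D Y → k ≤ ∣ Y ∣

  CertifiedComponents : ℕ → Subset (#V G) → Subset (#E G) → Subset (#V G) → Set
  CertifiedComponents z S D C =
    ∀ K → IsComponent G S D K → FvsIs G K (D ∩ inducedE G K) ∣ C ∩ K ∣ × ∣ C ∩ K ∣ ≤ z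

  module DisjointParts (S₁∩S₂=∅ : Disjoint G S₁ S₂) (wf₁ : WellFormed G S₁ D₁) (wf₂ : WellFormed G S₂ D₂) where

    FvsAtLeast-∪ : D₁ ⊆ D → D₂ ⊆ D → FvsAtLeast S₁ D₁ k₁ → FvsAtLeast S₂ D₂ k₂ → FvsAtLeast S D (k₁ + k₂)
    FvsAtLeast-∪ D₁⊆D D₂⊆D fvs₁ fvs₂ Y Y-fvs =
      ≤-trans (+-mono-≤ (fvs₁ _ (IsFVS-restrict wf₁ D₁⊆D Y-fvs)) (fvs₂ _ (IsFVS-restrict wf₂ D₂⊆D Y-fvs)))
              (∣p∩q∣+∣p∩r∣≤∣p∣ Y S₁ S₂ S₁∩S₂=∅)

    module _ (D⊆D₁∪D₂ : D ⊆ D₁ ∪ D₂) where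

      Reach-within : Reach G D u v → u ∈ S₁ → Reach G D₁ u v × v ∈ S₁
      Reach-within here u∈S₁ = here , u∈S₁
      Reach-within (there e e∈D j r) u∈S₁ with x∈p∪q⁻ D₁ D₂ (D⊆D₁∪D₂ e∈D)
      ... | inj₂ e∈D₂ = contradiction (proj₁ (WellFormed-Joins wf₂ e∈D₂ j)) (S₁∩S₂=∅ _ u∈S₁)
      ... | inj₁ e∈D₁ with Reach-within r (proj₂ (WellFormed-Joins wf₁ e∈D₁ j))
      ...   | r₁ , v∈S₁ = there e e∈D₁ j r₁ , v∈S₁

      component-within : D₁ ⊆ D → IsComponent G S D K → v ∈ K → v ∈ S₁ → IsComponent G S₁ D₁ K
      component-within {K = K} D₁⊆D (_ , nonempty , connected , closed) v∈K v∈S₁ =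
        K⊆S₁ , nonempty , (λ x y x∈K y∈K → proj₁ (Reach-within (connected x y x∈K y∈K) (K⊆S₁ x∈K)))
             , (λ e e∈D₁ → closed e (D₁⊆D e∈D₁))
        where
        K⊆S₁ : K ⊆ S₁
        K⊆S₁ x∈K = proj₂ (Reach-within (connected _ _ v∈K x∈K) v∈S₁)

      inducedE-within : D₁ ⊆ D → K ⊆ S₁ → D ∩ inducedE G K ≡ D₁ ∩ inducedE G K
      inducedE-within D₁⊆D K⊆S₁ = p∩s≡q∩s D⊆D₁∪D₂ D₁⊆D
        λ e e∈ e∈D₂ → S₁∩S₂=∅ _ (K⊆S₁ (proj₁ (inducedE-wellFormed e e∈))) (proj₁ (wf₂ e e∈D₂))

      Cycle-split : Cycle G D → Cycle G (D ∩ D₁) ⊎ Cycle G (D ∩ D₂)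
      Cycle-split c = by-side (vs zero ∈? S₁)
        where
        open Cycle c

        never-leaves : ∀ {i} → ¬ Leaves (_∈ S₁) (es i)
        never-leaves {i} (u , w , j , u∈S₁ , w∉S₁) with x∈p∪q⁻ D₁ D₂ (D⊆D₁∪D₂ (es-in i))
        ... | inj₁ e∈D₁ = w∉S₁ (proj₂ (WellFormed-Joins wf₁ e∈D₁ j))
        ... | inj₂ e∈D₂ = S₁∩S₂=∅ u u∈S₁ (proj₁ (WellFormed-Joins wf₂ e∈D₂ j))

        confined : ∀ {i} → vs i ∈ S₁ → ∀ j → vs j ∈ S₁
        confined = cycle-confined c (_∈ S₁) (_∈? S₁) (λ l _ → ⊥-elim (never-leaves l))

        edge-in₁ : ∀ i → vs i ∈ S₁ → es i ∈ D₁
        edge-in₁ i vᵢ∈S₁ with x∈p∪q⁻ D₁ D₂ (D⊆D₁∪D₂ (es-in i))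
        ... | inj₁ e∈D₁ = e∈D₁
        ... | inj₂ e∈D₂ = contradiction (proj₁ (WellFormed-Joins wf₂ e∈D₂ (proj₂ (edge-from c i)))) (S₁∩S₂=∅ _ vᵢ∈S₁)

        edge-in₂ : ∀ i → vs i ∉ S₁ → es i ∈ D₂
        edge-in₂ i vᵢ∉S₁ with x∈p∪q⁻ D₁ D₂ (D⊆D₁∪D₂ (es-in i))
        ... | inj₁ e∈D₁ = contradiction (proj₁ (WellFormed-Joins wf₁ e∈D₁ (proj₂ (edge-from c i)))) vᵢ∉S₁
        ... | inj₂ e∈D₂ = e∈D₂

        by-side : Dec (vs zero ∈ S₁) → Cycle G (D ∩ D₁) ⊎ Cycle G (D ∩ D₂)
        by-side (yes v₀∈S₁) = inj₁ (Cycle-within c λ i → x∈p∩q⁺ (es-in i , edge-in₁ i (confined v₀∈S₁ i)))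
        by-side (no v₀∉S₁) =
          inj₂ (Cycle-within c λ i → x∈p∩q⁺ (es-in i , edge-in₂ i λ vᵢ∈S₁ → v₀∉S₁ (confined vᵢ∈S₁ zero)))

      certified-component : ∀ {z C C₁ C₂} → D₁ ⊆ D → C ⊆ C₁ ∪ C₂ → C₁ ⊆ C → C₂ ⊆ S₂
        → CertifiedComponents z S₁ D₁ C₁ → IsComponent G S D K → v ∈ K → v ∈ S₁
        → FvsIs G K (D ∩ inducedE G K) ∣ C ∩ K ∣ × ∣ C ∩ K ∣ ≤ z
      certified-component {K = K} {z = z} D₁⊆D C⊆C₁∪C₂ C₁⊆C C₂⊆S₂ certified₁ K-comp v∈K v∈S₁
        = subst₂ (λ D′ C′ → FvsIs G K D′ ∣ C′ ∣ × ∣ C′ ∣ ≤ z)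
                 (sym (inducedE-within D₁⊆D K⊆S₁))
                 (sym (p∩s≡q∩s C⊆C₁∪C₂ C₁⊆C (λ x x∈K x∈C₂ → S₁∩S₂=∅ x (K⊆S₁ x∈K) (C₂⊆S₂ x∈C₂))))
                 (certified₁ K K-comp₁)
        where
        K-comp₁ : IsComponent G S₁ D₁ K
        K-comp₁ = component-within D₁⊆D K-comp v∈K v∈S₁
        K⊆S₁ : K ⊆ S₁
        K⊆S₁ = proj₁ K-comp₁

  certificate-∪ : ∀ {z A₁ A₂ C₁ C₂} → Disjoint G A₁ A₂
    → IsCertificate G z A₁ C₁ S₁ D₁ → IsCertificate G z A₂ C₂ S₂ D₂
    → IsCertificate G z (A₁ ∪ A₂) (C₁ ∪ C₂) (S₁ ∪ S₂) (D₁ ∪ D₂)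
  certificate-∪ {S₁ = S₁} {D₁ = D₁} {S₂ = S₂} {D₂ = D₂} {z = z} {A₁} {A₂} {C₁} {C₂} A₁∩A₂=∅
    (S₁⊆A₁ , D₁⊆ , wf₁ , ((C₁⊆S₁ , acyclic₁) , fvs₁) , certified₁)
    (S₂⊆A₂ , D₂⊆ , wf₂ , ((C₂⊆S₂ , acyclic₂) , fvs₂) , certified₂) =
    ∪-mono-⊆ S₁⊆A₁ S₂⊆A₂
    , ∪-⊆ (⊆-trans D₁⊆ (inducedE-mono (p⊆p∪q {p = A₁} A₂))) (⊆-trans D₂⊆ (inducedE-mono (q⊆p∪q A₁ A₂)))
    , wf
    , ((∪-mono-⊆ C₁⊆S₁ C₂⊆S₂ , acyclic) , fvs)
    , certified
    where
    S₁∩S₂=∅ : Disjoint G S₁ S₂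
    S₁∩S₂=∅ x x∈S₁ x∈S₂ = A₁∩A₂=∅ x (S₁⊆A₁ x∈S₁) (S₂⊆A₂ x∈S₂)

    open DisjointParts S₁∩S₂=∅ wf₁ wf₂
    module Swapped = DisjointParts (λ x x∈S₂ x∈S₁ → S₁∩S₂=∅ x x∈S₁ x∈S₂) wf₂ wf₁

    wf : WellFormed G (S₁ ∪ S₂) (D₁ ∪ D₂)
    wf e e∈ with x∈p∪q⁻ D₁ D₂ e∈
    ... | inj₁ e∈D₁ = let src∈ , tgt∈ = wf₁ e e∈D₁ in p⊆p∪q S₂ src∈ , p⊆p∪q S₂ tgt∈
    ... | inj₂ e∈D₂ = let src∈ , tgt∈ = wf₂ e e∈D₂ in q⊆p∪q S₁ S₂ src∈ , q⊆p∪q S₁ S₂ tgt∈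

    avoids : ∀ {Dᵢ Cᵢ} → Cᵢ ⊆ C₁ ∪ C₂
           → ((D₁ ∪ D₂) ∩ inducedE G (∁ (C₁ ∪ C₂))) ∩ Dᵢ ⊆ Dᵢ ∩ inducedE G (∁ Cᵢ)
    avoids Cᵢ⊆C e∈ with x∈p∩q⁻ _ _ e∈
    ... | e∈D∩ , e∈Dᵢ = x∈p∩q⁺ (e∈Dᵢ , inducedE-mono (p⊆q⇒∁p⊇∁q Cᵢ⊆C) (p∩q⊆q _ _ e∈D∩))

    acyclic : Acyclic G ((D₁ ∪ D₂) ∩ inducedE G (∁ (C₁ ∪ C₂)))
    acyclic c = [ Acyclic-anti (avoids (p⊆p∪q C₂)) acyclic₁ , Acyclic-anti (avoids (q⊆p∪q C₁ C₂)) acyclic₂ ]′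
                  (Cycle-split (p∩q⊆p _ _) c)

    fvs : FvsAtLeast (S₁ ∪ S₂) (D₁ ∪ D₂) ∣ C₁ ∪ C₂ ∣
    fvs = subst (FvsAtLeast (S₁ ∪ S₂) (D₁ ∪ D₂))
                (sym (∣p∪q∣≡∣p∣+∣q∣ C₁ C₂ λ x x∈C₁ x∈C₂ → S₁∩S₂=∅ x (C₁⊆S₁ x∈C₁) (C₂⊆S₂ x∈C₂)))
                (FvsAtLeast-∪ (p⊆p∪q D₂) (q⊆p∪q D₁ D₂) fvs₁ fvs₂)

    certified : CertifiedComponents z (S₁ ∪ S₂) (D₁ ∪ D₂) (C₁ ∪ C₂)
    certified K K-comp@(_ , (v , v∈K) , _) with x∈p∪q⁻ S₁ S₂ (proj₁ K-comp v∈K)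
    ... | inj₁ v∈S₁ = certified-component ⊆-refl {C = C₁ ∪ C₂} {C₁} {C₂}
                        (p⊆p∪q D₂) ⊆-refl (p⊆p∪q C₂) C₂⊆S₂ certified₁ K-comp v∈K v∈S₁
    ... | inj₂ v∈S₂ = Swapped.certified-component p∪q⊆q∪p {C = C₁ ∪ C₂} {C₂} {C₁}
                        (q⊆p∪q D₁ D₂) p∪q⊆q∪p (q⊆p∪q C₁ C₂) C₁⊆S₁ certified₂ K-comp v∈K v∈S₂

  FvsAtLeast-inducedE-∪ : Disjoint G S₁ S₂ → FvsAtLeast S₁ (inducedE G S₁) k₁ → FvsAtLeast S₂ (inducedE G S₂) k₂
                        → FvsAtLeast (S₁ ∪ S₂) (inducedE G (S₁ ∪ S₂)) (k₁ + k₂)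
  FvsAtLeast-inducedE-∪ {S₁ = S₁} {S₂ = S₂} S₁∩S₂=∅ =
    FvsAtLeast-∪ (inducedE-mono (p⊆p∪q {p = S₁} S₂)) (inducedE-mono (q⊆p∪q S₁ S₂))
    where open DisjointParts S₁∩S₂=∅ inducedE-wellFormed inducedE-wellFormed

  -- Gluing the two antlers

  forest-∪ : ∀ {F₁ F₂} → Acyclic G (inducedE G F₁)
    → (∀ K → IsComponent G F₁ (inducedE G F₁) K → cross G K X ≤ 1) → F₂ ⊆ X
    → Acyclic G (inducedE G F₂) → Acyclic G (inducedE G (F₁ ∪ F₂))
  forest-∪ {X = X} {F₁} {F₂} forest₁ exits₁ F₂⊆X forest₂ c = by-meeting (any? λ i → vs i ∈? F₁)
    where
    open Cycle c

    inside-component : ∀ {i} → Σ[ K ∈ Subset (#V G) ] (IsComponent G F₁ (inducedE G F₁) K × vs i ∈ K) → ⊥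
    inside-component (K , K-comp , vᵢ∈K) = forest₁ (Cycle-inducedE c λ j → proj₁ K-comp (confined j))
      where
      exit : ∀ {k} → Leaves (_∈ K) (es k) → Exit K X (es k)
      exit {k} (u , w , j , u∈K , w∉K) = u , w , j , u∈K , F₂⊆X (component-exit K-comp (es-in k) j u∈K w∉K)
      confined : ∀ j → vs j ∈ K
      confined = cycle-confined c (_∈ K) (_∈? K)
                   (λ l l′ → cross≤1⇒unique-exit (exits₁ K K-comp) (exit l) (exit l′)) vᵢ∈K

    by-meeting : Dec (∃[ i ] vs i ∈ F₁) → ⊥
    by-meeting (yes (i , vᵢ∈F₁)) = inside-component (component-of F₁ (vs i) vᵢ∈F₁)
    by-meeting (no misses-F₁) = forest₂ (Cycle-inducedE c in-F₂)
      where
      in-F₂ : ∀ i → vs i ∈ F₂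
      in-F₂ i with x∈p∪q⁻ F₁ F₂ (proj₁ (WellFormed-Joins inducedE-wellFormed (es-in i) (proj₂ (edge-from c i))))
      ... | inj₁ vᵢ∈F₁ = contradiction (i , vᵢ∈F₁) misses-F₁
      ... | inj₂ vᵢ∈F₂ = vᵢ∈F₂

  module _ {C₁ F₁ C₂ F₂ : Subset (#V G)} (F₂⊆W : F₂ ⊆ ∁ (C₁ ∪ F₁))
    (exits₁ : ∀ K → IsComponent G F₁ (inducedE G F₁) K → cross G K (⊤ ∩ ∁ (C₁ ∪ F₁)) ≤ 1)
    (exits₂ : ∀ K → IsComponent G F₂ (inducedE G F₂) K → cross G K (∁ (C₁ ∪ F₁) ∩ ∁ (C₂ ∪ F₂)) ≤ 1)
    where
    private
      Outside : Subset (#V G)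
      Outside = ⊤ ∩ ∁ ((C₁ ∪ C₂) ∪ (F₁ ∪ F₂))

      outside-∉ : ∀ {A} → A ⊆ (C₁ ∪ C₂) ∪ (F₁ ∪ F₂) → x ∈ Outside → x ∈ ∁ A
      outside-∉ A⊆ x∈O = x∉p⇒x∈∁p λ x∈A → x∈∁p⇒x∉p (p∩q⊆q ⊤ _ x∈O) (A⊆ x∈A)

      outside⇒W₁ : x ∈ Outside → x ∈ ⊤ ∩ ∁ (C₁ ∪ F₁)
      outside⇒W₁ x∈O = x∈p∩q⁺ (∈⊤ , outside-∉ (∪-mono-⊆ (p⊆p∪q C₂) (p⊆p∪q F₂)) x∈O)

      outside⇒W₂ : x ∈ Outside → x ∈ ∁ (C₁ ∪ F₁) ∩ ∁ (C₂ ∪ F₂)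
      outside⇒W₂ x∈O = x∈p∩q⁺ (p∩q⊆q ⊤ _ (outside⇒W₁ x∈O) , outside-∉ (∪-mono-⊆ (q⊆p∪q C₁ C₂) (q⊆p∪q F₁ F₂)) x∈O)

      outside⇒∉F₂ : x ∈ Outside → x ∉ F₂
      outside⇒∉F₂ x∈O = x∈∁p⇒x∉p (outside-∉ (λ x∈F₂ → q⊆p∪q (C₁ ∪ C₂) _ (q⊆p∪q F₁ F₂ x∈F₂)) x∈O)

      -- The exit e of K to Outside is its only edge into G - (C₁ ∪ F₁) ⊇ F₂.
      F₁-tree-closed : IsComponent G F₁ (inducedE G F₁) K → Exit K Outside e
                     → f ∈ inducedE G (F₁ ∪ F₂) → Joins G f x y → x ∈ K → y ∈ K
      F₁-tree-closed {K = K} {y = y} K-comp (u , w , j , u∈K , w∈O) f∈ jf x∈K with y ∈? K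
      ... | yes y∈K = y∈K
      ... | no y∉K with component-exit K-comp f∈ jf x∈K y∉K
      ...   | y∈F₂ with cross≤1⇒unique-exit (exits₁ K K-comp) (u , w , j , u∈K , outside⇒W₁ w∈O)
                                                              (_ , y , jf , x∈K , x∈p∩q⁺ (∈⊤ , F₂⊆W y∈F₂))
      ...     | refl with Joins-endpoint j (Joins-sym jf)
      ...       | inj₁ refl = contradiction u∈K y∉K
      ...       | inj₂ refl = contradiction y∈F₂ (outside⇒∉F₂ w∈O)

      exit-via-F₁ : u ∈ F₁ → Joins G e u w → w ∈ Outside → Joins G e′ u′ w′ → w′ ∈ Outside
                  → Reach G (inducedE G (F₁ ∪ F₂)) u u′ → e ≡ e′
      exit-via-F₁ {u = u} {e = e} {e′ = e′} {u′ = u′} u∈F₁ j w∈O j′ w′∈O u⇝u′ = via (component-of F₁ u u∈F₁)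
        where
        via : Σ[ K ∈ Subset (#V G) ] (IsComponent G F₁ (inducedE G F₁) K × u ∈ K) → e ≡ e′
        via (K , K-comp , u∈K) = cross≤1⇒unique-exit (exits₁ K K-comp) (_ , _ , j , u∈K , outside⇒W₁ w∈O)
                                                                        (_ , _ , j′ , u′∈K , outside⇒W₁ w′∈O)
          where
          u′∈K : u′ ∈ K
          u′∈K = Reach-preserves (_∈ K) (F₁-tree-closed K-comp (_ , _ , j , u∈K , w∈O)) u⇝u′ u∈K

      -- Walking in G[F₁ ∪ F₂] from a tree T of G[F₂], one can only enter a tree of G[F₁] through its
      -- unique edge to G - (C₁ ∪ F₁), and therefore only leave it back into T.
      Attached : Subset (#V G) → Vertex → Set
      Attached T x = x ∈ T ⊎ Σ[ K ∈ Subset (#V G) ] (IsComponent G F₁ (inducedE G F₁) K × x ∈ K × ∃[ g ] Exit K T g)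

      attached-step : IsComponent G F₂ (inducedE G F₂) T → f ∈ inducedE G (F₁ ∪ F₂) → Joins G f x y
                    → Attached T x → Attached T y
      attached-step {y = y} T-comp f∈ jf (inj₁ x∈T)
        with x∈p∪q⁻ F₁ F₂ (proj₂ (WellFormed-Joins inducedE-wellFormed f∈ jf))
      ... | inj₂ y∈F₂ = inj₁ (component-closed T-comp (Joins-∈inducedE jf (proj₁ T-comp x∈T) y∈F₂) jf x∈T)
      ... | inj₁ y∈F₁ with component-of F₁ y y∈F₁
      ...   | K , K-comp , y∈K = inj₂ (K , K-comp , y∈K , _ , y , _ , Joins-sym jf , y∈K , x∈T)
      attached-step {y = y} T-comp f∈ jf (inj₂ (K , K-comp , x∈K , g , a , b , jg , a∈K , b∈T)) with y ∈? K
      ... | yes y∈K = inj₂ (K , K-comp , y∈K , g , a , b , jg , a∈K , b∈T)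
      ... | no y∉K with cross≤1⇒unique-exit (exits₁ K K-comp)
                          (_ , _ , jf , x∈K , x∈p∩q⁺ (∈⊤ , F₂⊆W (component-exit K-comp f∈ jf x∈K y∉K)))
                          (a , b , jg , a∈K , x∈p∩q⁺ (∈⊤ , F₂⊆W (proj₁ T-comp b∈T)))
      ...   | refl with Joins-endpoint jg (Joins-sym jf)
      ...     | inj₁ refl = contradiction a∈K y∉K
      ...     | inj₂ refl = inj₁ b∈T

      exit-via-F₂ : u ∈ F₂ → u′ ∉ F₁ → Joins G e u w → w ∈ Outside → Joins G e′ u′ w′ → w′ ∈ Outside
                  → Reach G (inducedE G (F₁ ∪ F₂)) u u′ → e ≡ e′
      exit-via-F₂ {u = u} {u′ = u′} {e = e} {e′ = e′} u∈F₂ u′∉F₁ j w∈O j′ w′∈O u⇝u′ = via (component-of F₂ u u∈F₂)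
        where
        via : Σ[ T ∈ Subset (#V G) ] (IsComponent G F₂ (inducedE G F₂) T × u ∈ T) → e ≡ e′
        via (T , T-comp , u∈T) with Reach-preserves (Attached T) (attached-step T-comp) u⇝u′ (inj₁ u∈T)
        ... | inj₁ u′∈T = cross≤1⇒unique-exit (exits₂ T T-comp) (_ , _ , j , u∈T , outside⇒W₂ w∈O)
                                                                  (_ , _ , j′ , u′∈T , outside⇒W₂ w′∈O)
        ... | inj₂ (K , K-comp , u′∈K , _) = contradiction (proj₁ K-comp u′∈K) u′∉F₁

    crossing-∪ : ∀ T → IsComponent G (F₁ ∪ F₂) (inducedE G (F₁ ∪ F₂)) T
               → cross G T (⊤ ∩ ∁ ((C₁ ∪ C₂) ∪ (F₁ ∪ F₂))) ≤ 1
    crossing-∪ T (T⊆F , _ , connected , _) = unique-exit⇒cross≤1 unique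
      where
      in-F₂ : x ∈ T → x ∉ F₁ → x ∈ F₂
      in-F₂ x∈T x∉F₁ = [ (λ x∈F₁ → contradiction x∈F₁ x∉F₁) , (λ x∈F₂ → x∈F₂) ]′ (x∈p∪q⁻ F₁ F₂ (T⊆F x∈T))

      unique : Exit T Outside e → Exit T Outside e′ → e ≡ e′
      unique (u , w , j , u∈T , w∈O) (u′ , w′ , j′ , u′∈T , w′∈O) with u ∈? F₁ | u′ ∈? F₁
      ... | yes u∈F₁ | _ = exit-via-F₁ u∈F₁ j w∈O j′ w′∈O (connected u u′ u∈T u′∈T)
      ... | no _ | yes u′∈F₁ = sym (exit-via-F₁ u′∈F₁ j′ w′∈O j w∈O (connected u′ u u′∈T u∈T))
      ... | no u∉F₁ | no u′∉F₁ = exit-via-F₂ (in-F₂ u∈T u∉F₁) u′∉F₁ j w∈O j′ w′∈O (connected u u′ u∈T u′∈T)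

lemma12 : (G : Multigraph) (z : ℕ) (C₁ F₁ C₂ F₂ : Subset (#V G))
    → IsZAntler G z ⊤ C₁ F₁
    → IsZAntler G z (∁ (C₁ ∪ F₁)) C₂ F₂
    → IsZAntler G z ⊤ (C₁ ∪ C₂) (F₁ ∪ F₂)
lemma12 G z C₁ F₁ C₂ F₂
  (((_ , _ , C₁∩F₁=∅ , forest₁ , exits₁) , fvs₁) , S₁ , D₁ , certificate₁)
  (((C₂⊆W , F₂⊆W , C₂∩F₂=∅ , forest₂ , exits₂) , fvs₂) , S₂ , D₂ , certificate₂) =
  ( ( (λ _ → ∈⊤) , (λ _ → ∈⊤) , C∩F=∅
    , forest-∪ G forest₁ exits₁ (λ x∈F₂ → x∈p∩q⁺ (∈⊤ , F₂⊆W x∈F₂)) forest₂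
    , crossing-∪ G F₂⊆W exits₁ exits₂ )
  , subst₂ (λ A k → FvsAtLeast G A (inducedE G A) k) regroup (sym ∣C₁∪C₂∣)
           (FvsAtLeast-inducedE-∪ G A₁∩A₂=∅ fvs₁ fvs₂) )
  , S₁ ∪ S₂ , D₁ ∪ D₂
  , subst (λ A → IsCertificate G z A (C₁ ∪ C₂) (S₁ ∪ S₂) (D₁ ∪ D₂)) regroup
          (certificate-∪ G A₁∩A₂=∅ certificate₁ certificate₂)
  where
  regroup : (C₁ ∪ F₁) ∪ (C₂ ∪ F₂) ≡ (C₁ ∪ C₂) ∪ (F₁ ∪ F₂)
  regroup = ∪-interchange C₁ F₁ C₂ F₂

  A₁∩A₂=∅ : Disjoint G (C₁ ∪ F₁) (C₂ ∪ F₂)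
  A₁∩A₂=∅ x x∈A₁ x∈A₂ = x∈∁p⇒x∉p (∪-⊆ C₂⊆W F₂⊆W x∈A₂) x∈A₁

  ∣C₁∪C₂∣ : ∣ C₁ ∪ C₂ ∣ ≡ ∣ C₁ ∣ + ∣ C₂ ∣
  ∣C₁∪C₂∣ = ∣p∪q∣≡∣p∣+∣q∣ C₁ C₂ λ x x∈C₁ x∈C₂ → A₁∩A₂=∅ x (p⊆p∪q F₁ x∈C₁) (p⊆p∪q F₂ x∈C₂)

  C∩F=∅ : Disjoint G (C₁ ∪ C₂) (F₁ ∪ F₂)
  C∩F=∅ x x∈C x∈F with x∈p∪q⁻ C₁ C₂ x∈C | x∈p∪q⁻ F₁ F₂ x∈F
  ... | inj₁ x∈C₁ | inj₁ x∈F₁ = C₁∩F₁=∅ x x∈C₁ x∈F₁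
  ... | inj₁ x∈C₁ | inj₂ x∈F₂ = A₁∩A₂=∅ x (p⊆p∪q F₁ x∈C₁) (q⊆p∪q C₂ F₂ x∈F₂)
  ... | inj₂ x∈C₂ | inj₁ x∈F₁ = A₁∩A₂=∅ x (q⊆p∪q C₁ F₁ x∈F₁) (p⊆p∪q F₂ x∈C₂)
  ... | inj₂ x∈C₂ | inj₂ x∈F₂ = C₂∩F₂=∅ x x∈C₂ x∈F₂
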